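{- For any optimal packing of a set of items into a sequence of bins, there is an optimal thrifty packing of those items into that sequence using the same set of bins.
   Context: Items have positive integer sizes; bins arrive in a sequence and have positive integer sizes. A packing assigns every item to a bin so that the total size of items in each bin is at most its size. A packing is valid if each empty bin is smaller than every item packed in a later bin. The cost of a packing is the sum of sizes of the bins it uses (bins receiving at least one item). A packing is optimal if it is valid and has cost at most that of any other valid packing of the same items into the same sequence. A bin is wasteful if its empty space is at least as large as some item packed in a later bin; a packing is thrifty if it has no wasteful bins. -}

module Defs where

open import Data.Nat using (ℕ; _≤_; _<_; _∸_)
open import Data.Fin using (Fin; toℕ; _≟_)
open import Data.Fin.Properties using (any?)
open import Data.List using (List; map; filter; allFin)
open import Data.Nat.ListAction using (sum)
open import Data.Product using (∃; Σ; _×_; _,_)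
open import Relation.Binary.PropositionalEquality using (_≡_)
open import Relation.Nullary using (¬_)

-- n items with sizes  item : Fin n → ℕ ;  m bins, in sequence order 0,1,..,m-1,
-- with sizes  bin : Fin m → ℕ .  A packing assigns each item to a bin.
Packing : ℕ → ℕ → Set
Packing n m = Fin n → Fin m

module _ {n m : ℕ} (item : Fin n → ℕ) (bin : Fin m → ℕ) where

  load : Packing n m → Fin m → ℕ
  load p j = sum (map item (filter (λ i → p i ≟ j) (allFin n)))

  Used : Packing n m → Fin m → Set
  Used p j = ∃ λ i → p i ≡ j

  Empty : Packing n m → Fin m → Set
  Empty p j = ¬ Used p j

  Later : Fin m → Fin m → Set
  Later j j' = toℕ j < toℕ j'

  Fits : Packing n m → Set
  Fits p = ∀ j → load p j ≤ bin j

  Valid : Packing n m → Set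
  Valid p = Fits p ×
    (∀ j → Empty p j → ∀ i → Later j (p i) → bin j < item i)

  cost : Packing n m → ℕ
  cost p = sum (map bin (filter (λ j → any? (λ i → p i ≟ j)) (allFin m)))

  Optimal : Packing n m → Set
  Optimal p = Valid p × (∀ q → Valid q → cost p ≤ cost q)

  Wasteful : Packing n m → Fin m → Set
  Wasteful p j = ∃ λ i → Later j (p i) × item i ≤ bin j ∸ load p j

  Thrifty : Packing n m → Set
  Thrifty p = ∀ j → ¬ Wasteful p j

  SameBins : Packing n m → Packing n m → Set
  SameBins p q = ∀ j → (Used p j → Used q j) × (Used q j → Used p j)

-- Repeatedly move an item into an earlier bin whose free space can hold it.
-- Each move lowers the sum of the bin indices of the items, so this ends in a
-- packing with no wasteful bin; such a packing is valid, since an empty bin at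
-- least as large as a later item would be wasteful.  Every move targets a bin
-- used by the optimal packing p: items only ever move earlier, so the validity
-- of p forbids an empty bin of p from holding a later item.  Hence the final
-- packing uses a subset of the bins of p, and as bin sizes are positive, the
-- optimality of p forces the two sets of bins to coincide.
module Submission where

open import Data.Empty using (⊥-elim)
open import Data.Fin using (Fin; toℕ; _≟_)
open import Data.Fin.Properties using (any?)
open import Data.List using (List; []; _∷_; map; filter; allFin)
open import Data.List.Membership.Propositional using (_∈_)
open import Data.List.Membership.Propositional.Properties using (∈-allFin)
open import Data.List.Relation.Unary.All as All using (All; []; _∷_)
open import Data.List.Relation.Unary.Any using (here; there)
open import Data.List.Relation.Unary.Unique.Propositional using (Unique; []; _∷_)
open import Data.List.Relation.Unary.Unique.Propositional.Properties using (allFin⁺)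
open import Data.Nat using (ℕ; _+_; _∸_; _≤_; _<_; z≤n; _≤?_; _<?_)
open import Data.Nat.Induction using (<-wellFounded)
open import Data.Nat.ListAction using (sum)
open import Data.Nat.Properties hiding (_≟_)
open import Algebra.Properties.CommutativeSemigroup +-commutativeSemigroup using (x∙yz≈y∙xz)
open import Data.Product using (∃; _×_; _,_; proj₁)
open import Data.Sum using (_⊎_; inj₁; inj₂)
open import Data.Vec.Functional using (updateAt)
open import Data.Vec.Functional.Properties using (updateAt-updates; updateAt-minimal)
open import Function using (const)
open import Induction.WellFounded using (Acc; acc)
open import Level using (0ℓ)
open import Relation.Binary.Definitions using (DecidableEquality)
open import Relation.Binary.PropositionalEquality
open import Relation.Nullary using (yes; no; ¬_)
open import Relation.Nullary.Decidable using (_×-dec_)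
open import Relation.Unary using (Pred; Decidable; _⊆_)
open import Relation.Unary.Properties using (_∪?_)

open import Defs

module _ {A : Set} where

  sum-mono-≤ : (f g : A → ℕ) (xs : List A) → (∀ x → f x ≤ g x)
             → sum (map f xs) ≤ sum (map g xs)
  sum-mono-≤ f g []       f≤g = z≤n
  sum-mono-≤ f g (x ∷ xs) f≤g = +-mono-≤ (f≤g x) (sum-mono-≤ f g xs f≤g)

  sum-mono-< : (f g : A → ℕ) (xs : List A) → (∀ x → f x ≤ g x)
             → ∀ {y} → y ∈ xs → f y < g y → sum (map f xs) < sum (map g xs)
  sum-mono-< f g (x ∷ xs) f≤g (here refl)  fy<gy = +-mono-<-≤ fy<gy (sum-mono-≤ f g xs f≤g)
  sum-mono-< f g (x ∷ xs) f≤g (there y∈xs) fy<gy =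
    +-mono-≤-< (f≤g x) (sum-mono-< f g xs f≤g y∈xs fy<gy)

  module _ (f : A → ℕ) where

    filterSum : {P : Pred A 0ℓ} → Decidable P → List A → ℕ
    filterSum P? xs = sum (map f (filter P? xs))

    filterSum-⊆ : {P Q : Pred A 0ℓ} (P? : Decidable P) (Q? : Decidable Q) (xs : List A)
                → P ⊆ Q → filterSum P? xs ≤ filterSum Q? xs
    filterSum-⊆ P? Q? []       P⊆Q = z≤n
    filterSum-⊆ P? Q? (x ∷ xs) P⊆Q with P? x | Q? x
    ... | yes _  | yes _  = +-monoʳ-≤ (f x) (filterSum-⊆ P? Q? xs P⊆Q)
    ... | yes Px | no ¬Qx = ⊥-elim (¬Qx (P⊆Q Px))
    ... | no _   | yes _  = ≤-trans (filterSum-⊆ P? Q? xs P⊆Q) (m≤n+m _ (f x))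
    ... | no _   | no _   = filterSum-⊆ P? Q? xs P⊆Q

    filterSum-⊂ : {P Q : Pred A 0ℓ} (P? : Decidable P) (Q? : Decidable Q) (xs : List A)
                → P ⊆ Q → ∀ {y} → y ∈ xs → Q y → ¬ P y → 0 < f y
                → filterSum P? xs < filterSum Q? xs
    filterSum-⊂ P? Q? (x ∷ xs) P⊆Q (here refl) Qy ¬Py 0<fy with P? x | Q? x
    ... | yes Py | _      = ⊥-elim (¬Py Py)
    ... | no _   | no ¬Qy = ⊥-elim (¬Qy Qy)
    ... | no _   | yes _  = <-≤-trans (m<n+m _ 0<fy) (+-monoʳ-≤ (f x) (filterSum-⊆ P? Q? xs P⊆Q))
    filterSum-⊂ P? Q? (x ∷ xs) P⊆Q (there y∈xs) Qy ¬Py 0<fy with P? x | Q? x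
    ... | yes _  | yes _  = +-monoʳ-< (f x) (filterSum-⊂ P? Q? xs P⊆Q y∈xs Qy ¬Py 0<fy)
    ... | yes Px | no ¬Qx = ⊥-elim (¬Qx (P⊆Q Px))
    ... | no _   | yes _  = <-≤-trans (filterSum-⊂ P? Q? xs P⊆Q y∈xs Qy ¬Py 0<fy) (m≤n+m _ (f x))
    ... | no _   | no _   = filterSum-⊂ P? Q? xs P⊆Q y∈xs Qy ¬Py 0<fy

    filterSum-∪ : {P Q : Pred A 0ℓ} (P? : Decidable P) (Q? : Decidable Q) (xs : List A)
                → filterSum (P? ∪? Q?) xs ≤ filterSum P? xs + filterSum Q? xs
    filterSum-∪ P? Q? [] = z≤n
    filterSum-∪ P? Q? (x ∷ xs) with P? x | Q? x
    ... | yes _ | yes _ =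
      ≤-trans (+-monoʳ-≤ (f x) (≤-trans (filterSum-∪ P? Q? xs)
                                        (+-monoʳ-≤ (filterSum P? xs) (m≤n+m (filterSum Q? xs) (f x)))))
              (≤-reflexive (sym (+-assoc (f x) (filterSum P? xs) (f x + filterSum Q? xs))))
    ... | yes _ | no _  =
      ≤-trans (+-monoʳ-≤ (f x) (filterSum-∪ P? Q? xs))
              (≤-reflexive (sym (+-assoc (f x) (filterSum P? xs) (filterSum Q? xs))))
    ... | no _  | yes _ =
      ≤-trans (+-monoʳ-≤ (f x) (filterSum-∪ P? Q? xs))
              (≤-reflexive (x∙yz≈y∙xz (f x) (filterSum P? xs) (filterSum Q? xs)))
    ... | no _  | no _  = filterSum-∪ P? Q? xs

    filterSum-none : {P : Pred A 0ℓ} (P? : Decidable P) (xs : List A)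
                   → All (λ x → ¬ P x) xs → filterSum P? xs ≡ 0
    filterSum-none P? []       []           = refl
    filterSum-none P? (x ∷ xs) (¬Px ∷ ¬Pxs) with P? x
    ... | yes Px = ⊥-elim (¬Px Px)
    ... | no _   = filterSum-none P? xs ¬Pxs

    filterSum-≡ : (_≟ᴬ_ : DecidableEquality A) (a : A) (xs : List A) → Unique xs
                → filterSum (_≟ᴬ a) xs ≤ f a
    filterSum-≡ _≟ᴬ_ a []       []           = z≤n
    filterSum-≡ _≟ᴬ_ a (x ∷ xs) (x∉xs ∷ uxs) with x ≟ᴬ a
    ... | yes refl = ≤-reflexive (begin
      f x + filterSum (_≟ᴬ x) xs ≡⟨ cong (f x +_) (filterSum-none (_≟ᴬ x) xs (All.map ≢-sym x∉xs)) ⟩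
      f x + 0                    ≡⟨ +-identityʳ (f x) ⟩
      f x                        ∎)
      where open ≡-Reasoning
    ... | no _ = filterSum-≡ _≟ᴬ_ a xs uxs

module _ {n m : ℕ} (item : Fin n → ℕ) (bin : Fin m → ℕ) where

  move : Packing n m → Fin n → Fin m → Packing n m
  move s a t = updateAt s a (const t)

  move-moved : ∀ s a t → move s a t a ≡ t
  move-moved s a t = updateAt-updates a s

  move-other : ∀ s a t x → x ≡ a ⊎ move s a t x ≡ s x
  move-other s a t x with x ≟ a
  ... | yes x≡a = inj₁ x≡a
  ... | no x≢a  = inj₂ (updateAt-minimal x a s x≢a)

  load-move-target : ∀ s a t → load item bin (move s a t) t ≤ load item bin s t + item a
  load-move-target s a t = begin
    load item bin (move s a t) t
      ≤⟨ filterSum-⊆ item (λ x → move s a t x ≟ t) (sx≟t ∪? (_≟ a)) (allFin n) moved-from ⟩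
    filterSum item (sx≟t ∪? (_≟ a)) (allFin n)
      ≤⟨ filterSum-∪ item sx≟t (_≟ a) (allFin n) ⟩
    load item bin s t + filterSum item (_≟ a) (allFin n)
      ≤⟨ +-monoʳ-≤ _ (filterSum-≡ item _≟_ a (allFin n) (allFin⁺ n)) ⟩
    load item bin s t + item a ∎
    where
      open ≤-Reasoning
      sx≟t : Decidable (λ x → s x ≡ t)
      sx≟t x = s x ≟ t
      moved-from : ∀ {x} → move s a t x ≡ t → s x ≡ t ⊎ x ≡ a
      moved-from {x} moved with move-other s a t x
      ... | inj₁ x≡a  = inj₂ x≡a
      ... | inj₂ same = inj₁ (trans (sym same) moved)

  load-move-other : ∀ s a t j → j ≢ t → load item bin (move s a t) j ≤ load item bin s j
  load-move-other s a t j j≢t = filterSum-⊆ item _ _ (allFin n) stays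
    where
      stays : ∀ {x} → move s a t x ≡ j → s x ≡ j
      stays {x} moved with move-other s a t x
      ... | inj₁ refl = ⊥-elim (j≢t (trans (sym moved) (move-moved s a t)))
      ... | inj₂ same = trans (sym same) moved

  fits-move : ∀ s a t → Fits item bin s → item a ≤ bin t ∸ load item bin s t
            → Fits item bin (move s a t)
  fits-move s a t fits room j with j ≟ t
  ... | yes refl = begin
    load item bin (move s a j) j                    ≤⟨ load-move-target s a j ⟩
    load item bin s j + item a                      ≤⟨ +-monoʳ-≤ _ room ⟩
    load item bin s j + (bin j ∸ load item bin s j) ≡⟨ m+[n∸m]≡n (fits j) ⟩
    bin j                                           ∎
    where open ≤-Reasoning
  ... | no j≢t = ≤-trans (load-move-other s a t j j≢t) (fits j)

  used-move : ∀ s a t j → Used item bin (move s a t) j → Used item bin s j ⊎ j ≡ t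
  used-move s a t j (x , moved) with move-other s a t x
  ... | inj₁ refl = inj₂ (trans (sym moved) (move-moved s a t))
  ... | inj₂ same = inj₁ (x , trans (sym same) moved)

  height : Packing n m → ℕ
  height s = sum (map (λ x → toℕ (s x)) (allFin n))

  move-earlier : ∀ s a t → toℕ t < toℕ (s a) → ∀ x → toℕ (move s a t x) ≤ toℕ (s x)
  move-earlier s a t t<sa x with move-other s a t x
  ... | inj₁ refl = ≤-trans (≤-reflexive (cong toℕ (move-moved s a t))) (<⇒≤ t<sa)
  ... | inj₂ same = ≤-reflexive (cong toℕ same)

  height-move : ∀ s a t → toℕ t < toℕ (s a) → height (move s a t) < height s
  height-move s a t t<sa =
    sum-mono-< _ _ (allFin n) (move-earlier s a t t<sa) (∈-allFin a)
               (≤-<-trans (≤-reflexive (cong toℕ (move-moved s a t))) t<sa)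

  used? : ∀ s → Decidable (Used item bin s)
  used? s j = any? (λ i → s i ≟ j)

  wasteful? : ∀ s → Decidable (Wasteful item bin s)
  wasteful? s j = any? (λ i → (toℕ j <? toℕ (s i)) ×-dec (item i ≤? bin j ∸ load item bin s j))

  load-empty : ∀ s j → Empty item bin s j → load item bin s j ≡ 0
  load-empty s j empty =
    filterSum-none item _ (allFin n) (All.tabulate (λ {x} _ sx≡j → empty (x , sx≡j)))

  thrifty⇒valid : ∀ s → Fits item bin s → Thrifty item bin s → Valid item bin s
  thrifty⇒valid s fits thrifty = fits , smaller
    where
      smaller : ∀ j → Empty item bin s j → ∀ i → toℕ j < toℕ (s i) → bin j < item i
      smaller j empty i later = ≰⇒> λ i≤j →
        thrifty j (i , later , subst (λ l → item i ≤ bin j ∸ l) (sym (load-empty s j empty)) i≤j)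

  cost-mono : ∀ s q → Used item bin s ⊆ Used item bin q → cost item bin s ≤ cost item bin q
  cost-mono s q = filterSum-⊆ bin (used? s) (used? q) (allFin m)

  sameBins-from-cost : (∀ j → 0 < bin j) → ∀ p s → Used item bin s ⊆ Used item bin p
                     → cost item bin p ≤ cost item bin s → SameBins item bin p s
  sameBins-from-cost bin-pos p s s⊆p p≤s j = p→s , s⊆p
    where
      p→s : Used item bin p j → Used item bin s j
      p→s usedp with used? s j
      ... | yes useds = useds
      ... | no unused = ⊥-elim (<⇒≱ (filterSum-⊂ bin (used? s) (used? p) (allFin m) s⊆p
                                                   (∈-allFin j) usedp unused (bin-pos j)) p≤s)

  Compacted : Packing n m → Packing n m → Set
  Compacted p s = Fits item bin s × (∀ x → toℕ (s x) ≤ toℕ (p x)) × Used item bin s ⊆ Used item bin p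

  wasteful-used : ∀ p s → Valid item bin p → (∀ x → toℕ (s x) ≤ toℕ (p x))
                → ∀ t → Wasteful item bin s t → Used item bin p t
  wasteful-used p s (_ , smaller) s≤p t (a , later , room) with used? p t
  ... | yes used = used
  ... | no empty = ⊥-elim (<⇒≱ (smaller t empty a (<-≤-trans later (s≤p a)))
                                (≤-trans room (m∸n≤m (bin t) (load item bin s t))))

  compacted-move : ∀ p s → Valid item bin p → Compacted p s
                 → ∀ t → (w : Wasteful item bin s t) → Compacted p (move s (proj₁ w) t)
  compacted-move p s valid (fits , s≤p , s⊆p) t w@(a , later , room) =
    fits-move s a t fits room , (λ x → ≤-trans (move-earlier s a t later x) (s≤p x)) , used
    where
      used : Used item bin (move s a t) ⊆ Used item bin p
      used {j} u with used-move s a t j u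
      ... | inj₁ useds = s⊆p useds
      ... | inj₂ refl  = wasteful-used p s valid s≤p t w

  compact : ∀ p → Valid item bin p → ∀ s → Acc _<_ (height s) → Compacted p s
          → ∃ λ q → Thrifty item bin q × Compacted p q
  compact p valid s (acc rec) compacted with any? (wasteful? s)
  ... | no ¬wasteful = s , (λ j w → ¬wasteful (j , w)) , compacted
  ... | yes (t , w@(a , later , _)) =
    compact p valid (move s a t) (rec (height-move s a t later))
            (compacted-move p s valid compacted t w)

corollary1 : (n m : ℕ) (item : Fin n → ℕ) (bin : Fin m → ℕ)
    → (∀ i → 0 < item i) → (∀ j → 0 < bin j)
    → (p : Packing n m) → Optimal item bin p
    → ∃ λ q → Optimal item bin q × Thrifty item bin q × SameBins item bin p q
corollary1 n m item bin _ bin-pos p (valid , minimal)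
  with compact item bin p valid p (<-wellFounded _) (proj₁ valid , (λ _ → ≤-refl) , (λ u → u))
... | q , thrifty , (fits , _ , q⊆p) = q , (valid-q , cheapest) , thrifty , same-bins
  where
    valid-q : Valid item bin q
    valid-q = thrifty⇒valid item bin q fits thrifty

    cheapest : ∀ r → Valid item bin r → cost item bin q ≤ cost item bin r
    cheapest r valid-r = ≤-trans (cost-mono item bin q p q⊆p) (minimal r valid-r)

    same-bins : SameBins item bin p q
    same-bins = sameBins-from-cost item bin bin-pos p q q⊆p (minimal q valid-q)
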